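{- If $n\geq 2$ is an integer, then $|PF_{n,n-2}|=n^n-n^{n-2}$.
   Context: For integers $k\geq0$, $PF_{n,k}$ is the set of $k$-Naples parking functions of length $n$: tuples $(b_1,\dots,b_n)\in\{1,\dots,n\}^n$ such that, when cars $c_1,\dots,c_n$ arrive in order at spots $1,\dots,n$ (west to east) with $c_i$ preferring $b_i$, all cars park under the rule: $c_i$ parks at $b_i$ if it is empty; otherwise it checks the spots $b_i-1,\dots,b_i-k$ lying in $\{1,\dots,n\}$, one at a time in this order, and parks in the first empty one; if all are occupied it parks in the first empty spot among $b_i+1,\dots,n$, failing if there is none. -}

module Defs where

open import Data.Nat using (ℕ; zero; suc; _+_; _∸_)
open import Data.Nat.Properties using (_≟_)
open import Data.Bool using (Bool; true; false; if_then_else_)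
open import Data.Maybe using (Maybe; just; nothing)
open import Data.List using (List; []; _∷_)
open import Data.List.Membership.DecPropositional _≟_ using (_∈?_)
open import Data.Fin using (Fin; toℕ)
open import Data.Vec using (Vec; toList)
open import Data.Product using (Σ)
open import Relation.Nullary using (does)
open import Relation.Binary.PropositionalEquality using (_≡_)

-- Spots are the naturals 1..n; the occupancy state is the list of occupied spots.
Occ : Set
Occ = List ℕ

free : Occ → ℕ → Bool
free occ s = if does (s ∈? occ) then false else true

back : Occ → ℕ → ℕ → Maybe ℕ
back occ zero    j       = nothing
back occ (suc s) zero    = nothing
back occ (suc s) (suc j) = if free occ (suc s) then just (suc s) else back occ s j

fwd : Occ → ℕ → ℕ → Maybe ℕ
fwd occ s zero    = nothing
fwd occ s (suc j) = if free occ s then just s else fwd occ (suc s) j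

-- The k-Naples rule for a car preferring spot b (1 ≤ b ≤ n):
-- b if empty; else first empty among b-1, ..., b-k (within 1..n);
-- else first empty among b+1, ..., n; else failure (nothing).
parkOne : ℕ → ℕ → Occ → ℕ → Maybe ℕ
parkOne n k occ b with free occ b
... | true  = just b
... | false with back occ (b ∸ 1) k
...   | just s  = just s
...   | nothing = fwd occ (suc b) (n ∸ b)

parkAll : ℕ → ℕ → Occ → List ℕ → Bool
parkAll n k occ []       = true
parkAll n k occ (b ∷ bs) with parkOne n k occ b
... | nothing = false
... | just s  = parkAll n k (s ∷ occ) bs

-- A preference tuple (b₁,…,bₙ) ∈ {1,…,n}ⁿ, with bᵢ represented by a Fin n
-- value i ↦ toℕ i + 1.
prefs : ∀ {n} → Vec (Fin n) n → List ℕ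
prefs v = toList (Data.Vec.map (λ i → suc (toℕ i)) v)

IsNaplesPF : (n k : ℕ) → Vec (Fin n) n → Set
IsNaplesPF n k v = parkAll n k [] (prefs v) ≡ true

PF : ℕ → ℕ → Set
PF n k = Σ (Vec (Fin n) n) (IsNaplesPF n k)

module Submission where

-- Write n = m + 2. The proof compares (n-2)-Naples parking with Pollak's
-- circular parking on n spots, where a car takes the first empty spot
-- searching backwards cyclically from its preference.
--
--  * While street spot 1 is empty and at most m spots are taken, an m-Naples
--    car parks exactly where the circular rule puts it; once spot 1 is taken,
--    every remaining car parks. Hence a tuple fails exactly when its first
--    n - 1 cars leave only spot 1 empty and its last car prefers spot n.
--  * On the circle, n - 1 cars always leave exactly one spot empty, and
--    rotating preferences rotates the outcome, so Fin n × {tuples leaving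
--    spot 1 empty} ≅ all (n-1)-tuples (Pollak). Thus there are n^{n-2}
--    failing tuples, and n^n - n^{n-2} parking functions.

open import Defs
open import Data.Nat using (ℕ; zero; suc; _+_; _*_; _^_; _∸_; _≤_; _<_; z≤n; s≤s)
import Data.Nat
open import Data.Nat.Properties
  using (*-cancelˡ-≡; m+n∸n≡m; suc-injective; ≤-refl; ≤-trans; <-irrefl; +-suc; +-identityʳ; m≤m+n; n≤1+n; 1+n≰n;
         m≤n⇒m≤1+n; m≤n⇒m<n∨m≡n; ≤∧≢⇒<; ≤-reflexive; +-comm; <-cmp; m+[n∸m]≡n; m<m+n; ≤-pred; m≤n+m)
open import Data.Bool using (Bool; true; false; not; _∧_; if_then_else_)
import Data.Bool.Properties as Boolᵖ
open import Data.Fin using (Fin; zero; suc; toℕ; fromℕ; fromℕ<; inject₁)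
open import Data.Fin.Properties using (+↔⊎; *↔×; toℕ-inject₁; toℕ<n; injective⇒≤; ¬∀⟶∃¬)
import Data.Fin.Properties as Finᵖ
open import Data.Fin.Permutation using (↔⇒≡)
open import Data.List using (List; []; _∷_; _++_; map; length; lookup)
open import Data.List.Properties using (map-++; length-++)
open import Data.List.Relation.Unary.Any using (here; there; index)
open import Data.List.Relation.Unary.Any.Properties using (lookup-index)
open import Data.List.Membership.Propositional using (_∈_; _∉_)
open import Data.List.Membership.Propositional.Properties using (∈-map⁺; ∈-map⁻; ∈-lookup)
import Data.List.Membership.DecPropositional as DecMembership
open import Data.Vec using (Vec; []; _∷_; toList; _∷ʳ_; init; last; initLast)
import Data.Vec as Vec
open import Data.Vec.Properties using (toList-map; length-toList; map-∘; map-cong; map-id; map-∷ʳ; toList-∷ʳ; init-∷ʳ)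
open import Data.Product using (Σ; ∃; _×_; _,_; proj₁; proj₂)
open import Data.Product.Function.NonDependent.Propositional using (_×-↔_)
open import Data.Sum using (_⊎_; inj₁; inj₂; [_,_]′)
open import Data.Sum.Function.Propositional using (_⊎-↔_)
open import Data.Empty using (⊥-elim)
open import Data.Maybe using (just; nothing)
open import Function.Base using (_∘_)
open import Function.Bundles using (_↔_; Inverse; mk↔ₛ′)
open import Function.Properties.Inverse using (↔-refl; ↔-sym; ↔-trans)
open import Relation.Nullary using (Dec; yes; no; does; ¬_)
open import Relation.Nullary.Decidable using (dec-true; dec-false)
open import Relation.Binary.Definitions using (tri<; tri≈; tri>)
open import Relation.Binary.PropositionalEquality
open import Axiom.UniquenessOfIdentityProofs using (module Decidable⇒UIP)

Sub : {A : Set} → (A → Bool) → Set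
Sub {A} p = Σ A (λ a → p a ≡ true)

Sub-≡ : {A : Set} {p : A → Bool} {a b : A} {q : p a ≡ true} {r : p b ≡ true} →
        a ≡ b → _≡_ {A = Sub p} (a , q) (b , r)
Sub-≡ {q = q} {r} refl = cong (_ ,_) (Decidable⇒UIP.≡-irrelevant Boolᵖ._≟_ q r)

count : ∀ K → (Fin K → Bool) → ℕ
count zero    p = 0
count (suc K) p with p zero
... | true  = suc (count K (p ∘ suc))
... | false = count K (p ∘ suc)

Sub↔count : ∀ K (p : Fin K → Bool) → Sub p ↔ Fin (count K p)
Sub↔count zero    p = mk↔ₛ′ (λ { (() , _) }) (λ ()) (λ ()) (λ { (() , _) })
Sub↔count (suc K) p with p zero in p0 | Sub↔count K (p ∘ suc)
... | true  | rest = mk↔ₛ′ to from to∘from from∘to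
  where
  module R = Inverse rest
  to : Sub p → Fin (suc (count K (p ∘ suc)))
  to (zero  , _) = zero
  to (suc i , q) = suc (R.to (i , q))
  from : Fin (suc (count K (p ∘ suc))) → Sub p
  from zero    = zero , p0
  from (suc j) = suc (proj₁ (R.from j)) , proj₂ (R.from j)
  to∘from : ∀ j → to (from j) ≡ j
  to∘from zero    = refl
  to∘from (suc j) = cong suc (R.strictlyInverseˡ j)
  from∘to : ∀ x → from (to x) ≡ x
  from∘to (zero  , q) = Sub-≡ refl
  from∘to (suc i , q) rewrite R.strictlyInverseʳ (i , q) = refl
... | false | rest = mk↔ₛ′ to from R.strictlyInverseˡ from∘to
  where
  module R = Inverse rest
  to : Sub p → Fin (count K (p ∘ suc))
  to (zero  , q) = ⊥-elim (Boolᵖ.not-¬ refl (trans (sym p0) q))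
  to (suc i , q) = R.to (i , q)
  from : Fin (count K (p ∘ suc)) → Sub p
  from j = suc (proj₁ (R.from j)) , proj₂ (R.from j)
  from∘to : ∀ x → from (to x) ≡ x
  from∘to (zero  , q) = ⊥-elim (Boolᵖ.not-¬ refl (trans (sym p0) q))
  from∘to (suc i , q) rewrite R.strictlyInverseʳ (i , q) = refl

Sub-cong : {A B : Set} (e : A ↔ B) (p : A → Bool) → Sub p ↔ Sub (p ∘ Inverse.from e)
Sub-cong e p = mk↔ₛ′ to from (λ { (b , _) → Sub-≡ (E.strictlyInverseˡ b) })
                             (λ { (a , _) → Sub-≡ (E.strictlyInverseʳ a) })
  where
  module E = Inverse e
  to : Sub p → Sub (p ∘ E.from)
  to (a , q) = E.to a , trans (cong p (E.strictlyInverseʳ a)) q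
  from : Sub (p ∘ E.from) → Sub p
  from (b , q) = E.from b , q

Sub-finite : {A : Set} {K : ℕ} → A ↔ Fin K → (p : A → Bool) → Σ ℕ (λ c → Sub p ↔ Fin c)
Sub-finite {K = K} e p = _ , ↔-trans (Sub-cong e p) (Sub↔count K _)

Sub-split : {A : Set} (p : A → Bool) → A ↔ (Sub p ⊎ Sub (not ∘ p))
Sub-split {A} p = mk↔ₛ′ (λ a → split a (p a) refl) from to∘from (λ a → from∘split a (p a) refl)
  where
  split : ∀ a b → p a ≡ b → Sub p ⊎ Sub (not ∘ p)
  split a true  e = inj₁ (a , e)
  split a false e = inj₂ (a , cong not e)
  from : Sub p ⊎ Sub (not ∘ p) → A
  from (inj₁ (a , _)) = a
  from (inj₂ (a , _)) = a
  from∘split : ∀ a b (e : p a ≡ b) → from (split a b e) ≡ a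
  from∘split a true  e = refl
  from∘split a false e = refl
  split-yes : ∀ a b (e : p a ≡ b) (q : p a ≡ true) → split a b e ≡ inj₁ (a , q)
  split-yes a true  e q = cong inj₁ (Sub-≡ refl)
  split-yes a false e q = ⊥-elim (Boolᵖ.not-¬ refl (trans (sym e) q))
  split-no : ∀ a b (e : p a ≡ b) (q : not (p a) ≡ true) → split a b e ≡ inj₂ (a , q)
  split-no a true  e q = ⊥-elim (Boolᵖ.not-¬ refl (trans (sym (cong not e)) q))
  split-no a false e q = cong inj₂ (Sub-≡ refl)
  to∘from : ∀ x → split (from x) (p (from x)) refl ≡ x
  to∘from (inj₁ (a , q)) = split-yes a (p a) refl q
  to∘from (inj₂ (a , q)) = split-no a (p a) refl q

card-unique : {A : Set} {a b : ℕ} → A ↔ Fin a → A ↔ Fin b → a ≡ b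
card-unique e₁ e₂ = ↔⇒≡ (↔-trans (↔-sym e₁) e₂)

Sub-complement : {A : Set} {t c : ℕ} (p : A → Bool) →
                 A ↔ Fin t → Sub (not ∘ p) ↔ Fin c → Sub p ↔ Fin (t ∸ c)
Sub-complement {t = t} {c} p eA eFail = subst (λ s → Sub p ↔ Fin s) s≡t∸c ePass
  where
  s = proj₁ (Sub-finite eA p)
  ePass = proj₂ (Sub-finite eA p)
  t≡s+c : t ≡ s + c
  t≡s+c = card-unique eA (↔-trans (Sub-split p) (↔-trans (ePass ⊎-↔ eFail) (↔-sym +↔⊎)))
  s≡t∸c : s ≡ t ∸ c
  s≡t∸c = trans (sym (m+n∸n≡m s c)) (cong (_∸ c) (sym t≡s+c))

factor-cancel : {A : Set} {a n c : ℕ} → A ↔ Fin a →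
                (Fin (suc n) × A) ↔ Fin (suc n * c) → A ↔ Fin c
factor-cancel {a = a} {n} {c} eA eProd = subst (λ s → _ ↔ Fin s) a≡c eA
  where
  a≡c : a ≡ c
  a≡c = *-cancelˡ-≡ a c (suc n)
          (card-unique (↔-sym *↔×) (↔-trans (↔-refl ×-↔ ↔-sym eA) eProd))

Vec↔Fin^ : ∀ N k → Vec (Fin N) k ↔ Fin (N ^ k)
Vec↔Fin^ N zero    = mk↔ₛ′ (λ _ → zero) (λ _ → []) (λ { zero → refl }) (λ { [] → refl })
Vec↔Fin^ N (suc k) = ↔-trans uncons (↔-trans (↔-refl ×-↔ Vec↔Fin^ N k) (↔-sym *↔×))
  where
  uncons : Vec (Fin N) (suc k) ↔ (Fin N × Vec (Fin N) k)
  uncons = mk↔ₛ′ (λ { (x ∷ xs) → x , xs }) (λ { (x , xs) → x ∷ xs })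
                 (λ { (x , xs) → refl }) (λ { (x ∷ xs) → refl })

iter : {A : Set} → (A → A) → ℕ → A → A
iter f zero    x = x
iter f (suc k) x = f (iter f k x)

iter-comm : {A : Set} (f g : A → A) → (∀ x → f (g x) ≡ g (f x)) →
            ∀ k x → iter f k (g x) ≡ g (iter f k x)
iter-comm f g fg zero    x = refl
iter-comm f g fg (suc k) x = trans (cong f (iter-comm f g fg k x)) (fg _)

iter-inverse : {A : Set} (f g : A → A) → (∀ x → f (g x) ≡ x) →
               ∀ k x → iter f k (iter g k x) ≡ x
iter-inverse f g fg zero    x = refl
iter-inverse f g fg (suc k) x = begin
  f (iter f k (g (iter g k x))) ≡⟨ iter-comm f f (λ _ → refl) k _ ⟨
  iter f k (f (g (iter g k x))) ≡⟨ cong (iter f k) (fg _) ⟩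
  iter f k (iter g k x)         ≡⟨ iter-inverse f g fg k x ⟩
  x                             ∎
  where open ≡-Reasoning

prev : ∀ {M} → Fin (suc M) → Fin (suc M)
prev {M} zero    = fromℕ M
prev     (suc i) = inject₁ i

next : ∀ {M} → Fin (suc M) → Fin (suc M)
next {zero}  zero    = zero
next {suc M} zero    = suc zero
next {suc M} (suc i) with next i
... | zero  = zero
... | suc j = suc (suc j)

next-fromℕ : ∀ M → next (fromℕ M) ≡ zero
next-fromℕ zero    = refl
next-fromℕ (suc M) rewrite next-fromℕ M = refl

next-inject₁ : ∀ {M} (i : Fin M) → next (inject₁ i) ≡ suc i
next-inject₁ {suc M} zero    = refl
next-inject₁ {suc M} (suc i) rewrite next-inject₁ i = refl

next-prev : ∀ {M} (x : Fin (suc M)) → next (prev x) ≡ x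
next-prev {M} zero    = next-fromℕ M
next-prev     (suc i) = next-inject₁ i

prev-next : ∀ {M} (x : Fin (suc M)) → prev (next x) ≡ x
prev-next {zero}  zero    = refl
prev-next {suc M} zero    = refl
prev-next {suc M} (suc i) with next i | prev-next i
... | zero  | e = cong suc e
... | suc j | e = cong suc e

rotate unrotate : ∀ {M} → ℕ → Fin (suc M) → Fin (suc M)
rotate   = iter next
unrotate = iter prev

rotate-toℕ : ∀ {M} (x : Fin (suc M)) → rotate (toℕ x) zero ≡ x
rotate-toℕ x = go (toℕ x) x refl
  where
  go : ∀ {M} k (x : Fin (suc M)) → toℕ x ≡ k → rotate k zero ≡ x
  go zero    zero    e = refl
  go (suc k) (suc i) e = trans (cong next (go k (inject₁ i) (trans (toℕ-inject₁ i) (suc-injective e))))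
                               (next-inject₁ i)

unrotate-rotate : ∀ {M} k (x : Fin (suc M)) → unrotate k (rotate k x) ≡ x
unrotate-rotate = iter-inverse prev next prev-next

rotate-unrotate : ∀ {M} k (x : Fin (suc M)) → rotate k (unrotate k x) ≡ x
rotate-unrotate = iter-inverse next prev next-prev

unrotate-toℕ : ∀ {M} (x : Fin (suc M)) → unrotate (toℕ x) x ≡ zero
unrotate-toℕ x = trans (cong (unrotate (toℕ x)) (sym (rotate-toℕ x))) (unrotate-rotate (toℕ x) zero)

injective-by : {A : Set} (f g : A → A) → (∀ x → g (f x) ≡ x) → ∀ {x y} → f x ≡ f y → x ≡ y
injective-by f g gf {x} {y} e = trans (sym (gf x)) (trans (cong g e) (gf y))

rotate-injective : ∀ {M} k {x y : Fin (suc M)} → rotate k x ≡ rotate k y → x ≡ y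
rotate-injective k = injective-by (rotate k) (unrotate k) (unrotate-rotate k)

unrotate-injective : ∀ {M} k {x y : Fin (suc M)} → unrotate k x ≡ unrotate k y → x ≡ y
unrotate-injective k = injective-by (unrotate k) (rotate k) (rotate-unrotate k)

rotate-prev : ∀ {M} k (x : Fin (suc M)) → rotate k (prev x) ≡ prev (rotate k x)
rotate-prev = iter-comm next prev (λ x → trans (next-prev x) (sym (prev-next x)))

unrotate-prev : ∀ {M} k (x : Fin (suc M)) → unrotate k (prev x) ≡ prev (unrotate k x)
unrotate-prev = iter-comm prev prev (λ _ → refl)

data Distinct {A : Set} : List A → Set where
  []  : Distinct []
  _∷_ : ∀ {x xs} → x ∉ xs → Distinct xs → Distinct (x ∷ xs)

lookup-injective : {A : Set} {xs : List A} → Distinct xs → ∀ {i j} → lookup xs i ≡ lookup xs j → i ≡ j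
lookup-injective (x∉ ∷ d) {zero}  {zero}  e = refl
lookup-injective (x∉ ∷ d) {zero}  {suc j} e = ⊥-elim (x∉ (subst (_∈ _) (sym e) (∈-lookup j)))
lookup-injective (x∉ ∷ d) {suc i} {zero}  e = ⊥-elim (x∉ (subst (_∈ _) e (∈-lookup i)))
lookup-injective (x∉ ∷ d) {suc i} {suc j} e = cong suc (lookup-injective d e)

distinct-length : ∀ {K} {xs : List (Fin K)} → Distinct xs → length xs ≤ K
distinct-length d = injective⇒≤ (lookup-injective d)

covering-length : ∀ {K} {xs : List (Fin K)} → (∀ x → x ∈ xs) → K ≤ length xs
covering-length {xs = xs} all = injective⇒≤ {f = λ x → index (all x)} index-injective
  where
  index-injective : ∀ {x y} → index (all x) ≡ index (all y) → x ≡ y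
  index-injective {x} {y} e =
    trans (lookup-index (all x)) (trans (cong (lookup xs) e) (sym (lookup-index (all y))))

missing-exists : ∀ {K} (xs : List (Fin K)) → length xs < K → ∃ λ z → z ∉ xs
missing-exists {K} xs short = ¬∀⟶∃¬ K (_∈ xs) (λ x → DecMembership._∈?_ Finᵖ._≟_ x xs)
  (λ all → <-irrefl refl (≤-trans short (covering-length all)))

missing-unique : ∀ {K} (xs : List (Fin (suc K))) → Distinct xs → length xs ≡ K →
                 ∀ {x y} → x ∉ xs → y ∉ xs → x ≡ y
missing-unique xs d len {x} {y} x∉ y∉ with x Finᵖ.≟ y
... | yes x≡y = x≡y
... | no  x≢y = ⊥-elim (1+n≰n (subst (λ l → suc (suc l) ≤ suc _) len (distinct-length (x∉′ ∷ (y∉ ∷ d)))))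
  where
  x∉′ : x ∉ y ∷ xs
  x∉′ (here x≡y)  = x≢y x≡y
  x∉′ (there x∈) = x∉ x∈

map-inverse : {A : Set} {n : ℕ} (f g : A → A) → (∀ x → f (g x) ≡ x) → (v : Vec A n) → Vec.map f (Vec.map g v) ≡ v
map-inverse f g fg v = begin
  Vec.map f (Vec.map g v) ≡⟨ map-∘ f g v ⟨
  Vec.map (f ∘ g) v       ≡⟨ map-cong fg v ⟩
  Vec.map (λ x → x) v     ≡⟨ map-id v ⟩
  v                       ∎
  where open ≡-Reasoning

∧-true : ∀ {a b} → a ∧ b ≡ true → a ≡ true × b ≡ true
∧-true {true} b≡true = refl , b≡true

does-true : {P : Set} (p? : Dec P) → does p? ≡ true → P
does-true (yes p) _ = p

does-false : {P : Set} (p? : Dec P) → does p? ≡ false → ¬ P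
does-false (no ¬p) _ = ¬p

-- Parking on a circle (Pollak's argument)
--
-- Rotating all preferences rotates the outcome, and
-- after M cars exactly one spot is empty, which singles out one tuple in
-- each rotation class whose empty spot is 0.

module _ {M : ℕ} where

  private
    Spot = Fin (suc M)

  open DecMembership (Finᵖ._≟_ {suc M}) using (_∈?_)

  occupied? : List Spot → Spot → Bool
  occupied? occ x = does (x ∈? occ)

  seek : List Spot → Spot → ℕ → Spot
  seek occ b zero       = b
  seek occ b (suc fuel) = if occupied? occ b then seek occ (prev b) fuel else b

  parkCircle : List Spot → List Spot → List Spot
  parkCircle occ []       = occ
  parkCircle occ (b ∷ bs) = parkCircle (seek occ b (suc M) ∷ occ) bs

  parkCircle-mono : ∀ {occ z} bs → z ∈ occ → z ∈ parkCircle occ bs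
  parkCircle-mono []       z∈ = z∈
  parkCircle-mono (b ∷ bs) z∈ = parkCircle-mono bs (there z∈)

  module Equivariance (g : Spot → Spot) (g-injective : ∀ {x y} → g x ≡ g y → x ≡ y)
                      (g-prev : ∀ x → g (prev x) ≡ prev (g x)) where

    ∉-map : ∀ {occ x} → x ∉ occ → g x ∉ map g occ
    ∉-map {occ} x∉ gx∈ with ∈-map⁻ g gx∈
    ... | y , y∈ , gx≡gy = x∉ (subst (_∈ occ) (sym (g-injective gx≡gy)) y∈)

    occupied?-map : ∀ occ x → occupied? (map g occ) (g x) ≡ occupied? occ x
    occupied?-map occ x with x ∈? occ
    ... | yes x∈ = dec-true  (g x ∈? map g occ) (∈-map⁺ g x∈)
    ... | no  x∉ = dec-false (g x ∈? map g occ) (∉-map x∉)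

    seek-map : ∀ occ b fuel → seek (map g occ) (g b) fuel ≡ g (seek occ b fuel)
    seek-map occ b zero = refl
    seek-map occ b (suc fuel) rewrite occupied?-map occ b with occupied? occ b
    ... | true  = trans (cong (λ c → seek (map g occ) c fuel) (sym (g-prev b))) (seek-map occ (prev b) fuel)
    ... | false = refl

    parkCircle-map : ∀ occ bs → parkCircle (map g occ) (map g bs) ≡ map g (parkCircle occ bs)
    parkCircle-map occ []       = refl
    parkCircle-map occ (b ∷ bs) rewrite seek-map occ b (suc M) = parkCircle-map (seek occ b (suc M) ∷ occ) bs

  module Rotate   (k : ℕ) = Equivariance (rotate k)   (rotate-injective k)   (rotate-prev k)
  module Unrotate (k : ℕ) = Equivariance (unrotate k) (unrotate-injective k) (unrotate-prev k)

  -- If 0 is unoccupied, a search from y that may pass toℕ y occupied spots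
  -- ends at an unoccupied spot (it never needs to wrap around).
  seek-free-from-zero : ∀ occ → zero ∉ occ → ∀ fuel (y : Spot) → toℕ y < fuel → seek occ y fuel ∉ occ
  seek-free-from-zero occ 0∉ (suc fuel) y y<fuel with occupied? occ y in e
  ... | false = does-false (y ∈? occ) e
  seek-free-from-zero occ 0∉ (suc fuel) zero    _            | true = ⊥-elim (0∉ (does-true (zero ∈? occ) e))
  seek-free-from-zero occ 0∉ (suc fuel) (suc i) (s≤s i<fuel) | true =
    seek-free-from-zero occ 0∉ fuel (inject₁ i) (subst (_< fuel) (sym (toℕ-inject₁ i)) i<fuel)

  -- A full search finds an unoccupied spot whenever one exists: rotate that
  -- spot to 0 and apply the previous lemma.
  seek-free : ∀ occ {z} → z ∉ occ → ∀ b → seek occ b (suc M) ∉ occ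
  seek-free occ {z} z∉ b found = rotated-free (∈-map⁺ g found)
    where
    k = toℕ z
    g = unrotate k
    0∉ : zero ∉ map g occ
    0∉ = subst (_∉ map g occ) (unrotate-toℕ z) (Unrotate.∉-map k z∉)
    rotated-free : g (seek occ b (suc M)) ∉ map g occ
    rotated-free = subst (_∉ map g occ) (Unrotate.seek-map k occ b (suc M))
                         (seek-free-from-zero (map g occ) 0∉ (suc M) (g b) (toℕ<n (g b)))

  parkCircle-distinct : ∀ occ bs → Distinct occ → length occ + length bs ≤ suc M →
    Distinct (parkCircle occ bs) × length (parkCircle occ bs) ≡ length occ + length bs
  parkCircle-distinct occ []       d room = d , sym (+-identityʳ _)
  parkCircle-distinct occ (b ∷ bs) d room
    with parkCircle-distinct (seek occ b (suc M) ∷ occ) bs (seek-free occ (proj₂ empty) b ∷ d)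
                             (subst (_≤ suc M) (+-suc _ _) room)
    where
    empty = missing-exists occ (≤-trans (s≤s (m≤m+n (length occ) _)) (subst (_≤ suc M) (+-suc _ _) room))
  ... | d′ , len = d′ , trans len (sym (+-suc _ _))

  circleOcc : Vec Spot M → List Spot
  circleOcc v = parkCircle [] (toList v)

  circleOcc-distinct : ∀ v → Distinct (circleOcc v) × length (circleOcc v) ≡ M
  circleOcc-distinct v with parkCircle-distinct [] (toList v) [] (subst (_≤ suc M) (sym (length-toList v)) (n≤1+n M))
  ... | d , len = d , trans len (length-toList v)

  circleOcc-rotate : ∀ k v → circleOcc (Vec.map (rotate k) v) ≡ map (rotate k) (circleOcc v)
  circleOcc-rotate k v = trans (cong (parkCircle []) (toList-map (rotate k) v)) (Rotate.parkCircle-map k [] (toList v))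

  circleOcc-unrotate : ∀ k v → circleOcc (Vec.map (unrotate k) v) ≡ map (unrotate k) (circleOcc v)
  circleOcc-unrotate k v = trans (cong (parkCircle []) (toList-map (unrotate k) v)) (Unrotate.parkCircle-map k [] (toList v))

  hole-exists : ∀ v → ∃ λ z → z ∉ circleOcc v
  hole-exists v = missing-exists (circleOcc v) (subst (_< suc M) (sym (proj₂ (circleOcc-distinct v))) ≤-refl)

  hole : Vec Spot M → Spot
  hole v = proj₁ (hole-exists v)

  hole-unique : ∀ v {y} → y ∉ circleOcc v → y ≡ hole v
  hole-unique v y∉ = missing-unique (circleOcc v) (proj₁ (circleOcc-distinct v)) (proj₂ (circleOcc-distinct v))
                                    y∉ (proj₂ (hole-exists v))

  Centered : Set
  Centered = Sub (λ w → not (occupied? (circleOcc w) zero))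

  -- Pollak's bijection: a tuple is a rotation of a unique centered tuple,
  -- the rotation being determined by its hole.
  pollak : (Spot × Centered) ↔ Vec Spot M
  pollak = mk↔ₛ′ to from to∘from from∘to
    where
    to : Spot × Centered → Vec Spot M
    to (j , (w , _)) = Vec.map (rotate (toℕ j)) w

    centered : ∀ v → not (occupied? (circleOcc (Vec.map (unrotate (toℕ (hole v))) v)) zero) ≡ true
    centered v = cong not (dec-false (zero ∈? _) (subst₂ _∉_ (unrotate-toℕ (hole v)) (sym (circleOcc-unrotate k v))
                                                              (Unrotate.∉-map k (proj₂ (hole-exists v)))))
      where k = toℕ (hole v)

    from : Vec Spot M → Spot × Centered
    from v = hole v , (Vec.map (unrotate (toℕ (hole v))) v , centered v)

    to∘from : ∀ v → to (from v) ≡ v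
    to∘from v = map-inverse (rotate k) (unrotate k) (rotate-unrotate k) v
      where k = toℕ (hole v)

    from∘to : ∀ x → from (to x) ≡ x
    from∘to (j , (w , c)) = cong₂ _,_ hole≡j (Sub-≡ (begin
        Vec.map (unrotate (toℕ (hole v))) v ≡⟨ cong (λ h → Vec.map (unrotate (toℕ h)) v) hole≡j ⟩
        Vec.map (unrotate k) v              ≡⟨ map-inverse (unrotate k) (rotate k) (unrotate-rotate k) w ⟩
        w                                   ∎))
      where
      open ≡-Reasoning
      k = toℕ j
      v = Vec.map (rotate k) w
      0∉ : zero ∉ circleOcc w
      0∉ = does-false (zero ∈? circleOcc w) (Boolᵖ.not-injective c)
      hole≡j : hole v ≡ j
      hole≡j = sym (hole-unique v (subst₂ _∉_ (rotate-toℕ j) (sym (circleOcc-rotate k w)) (Rotate.∉-map k 0∉)))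

-- The k-Naples rule on spots 1..n

module _ where
  open DecMembership Data.Nat._≟_ using (_∈?_)

  free-∉ : ∀ {L s} → free L s ≡ true → s ∉ L
  free-∉ {L} {s} e with s ∈? L
  ... | no s∉ = s∉

  free-∈ : ∀ {L s} → free L s ≡ false → s ∈ L
  free-∈ {L} {s} e with s ∈? L
  ... | yes s∈ = s∈

  ∉-free : ∀ {L s} → s ∉ L → free L s ≡ true
  ∉-free {L} {s} s∉ with s ∈? L
  ... | yes s∈ = ⊥-elim (s∉ s∈)
  ... | no  _  = refl

  ∈-free : ∀ {L s} → s ∈ L → free L s ≡ false
  ∈-free {L} {s} s∈ with s ∈? L
  ... | yes _  = refl
  ... | no  s∉ = ⊥-elim (s∉ s∈)

  back-just : ∀ L s j {s′} → back L s j ≡ just s′ → s′ ∉ L × 1 ≤ s′ × s′ ≤ s × s < s′ + j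
  back-just L (suc s) (suc j) e with free L (suc s) in fs
  back-just L (suc s) (suc j) refl | true = free-∉ fs , s≤s z≤n , ≤-refl , m<m+n (suc s) (s≤s z≤n)
  ... | false with back-just L s j e
  ...   | s′∉ , 1≤s′ , s′≤s , s<s′+j = s′∉ , 1≤s′ , m≤n⇒m≤1+n s′≤s , subst (suc (suc s) ≤_) (sym (+-suc _ j)) (s≤s s<s′+j)

  back-nothing : ∀ L s j → back L s j ≡ nothing → ∀ t → 1 ≤ t → t ≤ s → s < t + j → t ∈ L
  back-nothing L zero    j       e t (s≤s _) ()
  back-nothing L (suc s) zero    e t _ t≤s s<t = ⊥-elim (<-irrefl refl (≤-trans s<t (subst (_≤ suc s) (sym (+-identityʳ t)) t≤s)))
  back-nothing L (suc s) (suc j) e t 1≤t t≤s s<t+j with free L (suc s) in fs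
  ... | false with m≤n⇒m<n∨m≡n t≤s
  ...   | inj₂ refl       = free-∈ fs
  ...   | inj₁ (s≤s t≤s′) = back-nothing L s j e t 1≤t t≤s′ (≤-pred (subst (suc s <_) (+-suc t j) s<t+j))

  fwd-just : ∀ L s j {s′} → fwd L s j ≡ just s′ → s′ ∉ L × s ≤ s′ × s′ < s + j
  fwd-just L s (suc j) {s′} e with free L s in fs
  fwd-just L s (suc j) refl | true = free-∉ fs , ≤-refl , m<m+n s (s≤s z≤n)
  ... | false with fwd-just L (suc s) j e
  ...   | s′∉ , s<s′ , s′<1+s+j = s′∉ , ≤-trans (n≤1+n s) s<s′ , subst (s′ <_) (sym (+-suc s j)) s′<1+s+j

  fwd-nothing : ∀ L s j → fwd L s j ≡ nothing → ∀ t → s ≤ t → t < s + j → t ∈ L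
  fwd-nothing L s zero    e t s≤t t<s = ⊥-elim (<-irrefl refl (≤-trans t<s (subst (_≤ t) (sym (+-identityʳ s)) s≤t)))
  fwd-nothing L s (suc j) e t s≤t t<s+j with free L s in fs
  ... | false with m≤n⇒m<n∨m≡n s≤t
  ...   | inj₂ refl = free-∈ fs
  ...   | inj₁ s<t  = fwd-nothing L (suc s) j e t s<t (subst (t <_) (+-suc s j) t<s+j)

  parkOne-parks : ∀ {n k L b s} → 1 ≤ b → b ≤ n → parkOne n k L b ≡ just s →
                  s ∉ L × 1 ≤ s × s ≤ n × b ≤ s + k
  parkOne-parks {n} {k} {L} {suc b} 1≤b b≤n e with free L (suc b) in fb
  parkOne-parks {n} {k} {L} {suc b} 1≤b b≤n refl | true = free-∉ fb , 1≤b , b≤n , m≤m+n (suc b) k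
  ... | false with back L b k in eb
  parkOne-parks {n} {k} {L} {suc b} 1≤b b≤n refl | false | just s with back-just L b k eb
  ...   | s∉ , 1≤s , s≤b , b<s+k = s∉ , 1≤s , ≤-trans s≤b (≤-trans (n≤1+n b) b≤n) , b<s+k
  parkOne-parks {n} {k} {L} {suc b} {s} 1≤b b≤n e | false | nothing with fwd-just L (suc (suc b)) (n ∸ suc b) e
  ...   | s∉ , b<s , s<end = s∉ , ≤-trans (s≤s z≤n) b<s , ≤-pred (subst (s <_) (cong suc (m+[n∸m]≡n b≤n)) s<end)
                           , ≤-trans (n≤1+n _) (≤-trans b<s (m≤m+n _ k))

  parkOne-fails : ∀ {n k L b} → b ≤ n → parkOne n k L b ≡ nothing →
                  ∀ t → 1 ≤ t → t ≤ n → b ≤ t + k → t ∈ L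
  parkOne-fails {n} {k} {L} {b} b≤n e t 1≤t t≤n b≤t+k with free L b in fb
  ... | false with back L (b ∸ 1) k in eb
  ...   | nothing with <-cmp t b
  ...     | tri≈ _ refl _ = free-∈ fb
  ...     | tri> _ _ b<t  = fwd-nothing L (suc b) (n ∸ b) e t b<t
                                        (subst (t <_) (sym (cong suc (m+[n∸m]≡n b≤n))) (s≤s t≤n))
  parkOne-fails {n} {k} {L} {suc b} b≤n e t 1≤t t≤n b≤t+k | false | nothing | tri< (s≤s t≤b) _ _ =
    back-nothing L b k eb t 1≤t t≤b b≤t+k

  parkOne-free : ∀ n k L b → free L b ≡ true → parkOne n k L b ≡ just b
  parkOne-free n k L b fb rewrite fb = refl

  parkOne-back : ∀ n k L b {s} → free L b ≡ false → back L (b ∸ 1) k ≡ just s → parkOne n k L b ≡ just s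
  parkOne-back n k L b fb eb rewrite fb | eb = refl

  parkAll-step : ∀ {n k L b s} bs → parkOne n k L b ≡ just s → parkAll n k L (b ∷ bs) ≡ parkAll n k (s ∷ L) bs
  parkAll-step bs e rewrite e = refl

-- (n-2)-Naples parking versus parking on the circle
--
-- Write n = m + 2 and let spot i of the circle Fin n be spot i + 1 of the
-- street.

module Critical (m : ℕ) where

  N : ℕ
  N = suc (suc m)

  spot : Fin N → ℕ
  spot x = suc (toℕ x)

  street : List (Fin N) → Occ
  street = map spot

  spot-injective : ∀ {x y} → spot x ≡ spot y → x ≡ y
  spot-injective e = Finᵖ.toℕ-injective (suc-injective e)

  street-∈ : ∀ {occ x} → spot x ∈ street occ → x ∈ occ
  street-∈ {occ} sx∈ with ∈-map⁻ spot sx∈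
  ... | y , y∈ , sx≡sy = subst (_∈ occ) (sym (spot-injective sx≡sy)) y∈

  unspot : ∀ {t} → 1 ≤ t → t ≤ N → ∃ λ y → spot y ≡ t
  unspot {suc t} _ t<N = fromℕ< t<N , cong suc (Finᵖ.toℕ-fromℕ< t<N)

  open DecMembership (Finᵖ._≟_ {N}) using (_∈?_)

  free-street : ∀ occ x → free (street occ) (spot x) ≡ not (occupied? occ x)
  free-street occ x with x ∈? occ
  ... | yes x∈ = ∈-free (∈-map⁺ spot x∈)
  ... | no  x∉ = ∉-free (x∉ ∘ street-∈)

  parks-at-spot : ∀ {occ b s} → parkOne N m (street occ) (spot b) ≡ just s →
                  ∃ λ y → s ≡ spot y × y ∉ occ × spot b ≤ spot y + m
  parks-at-spot {occ} {b} e with parkOne-parks {N} {m} {street occ} {spot b} (s≤s z≤n) (toℕ<n b) e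
  ... | s∉ , 1≤s , s≤N , b≤s+m with unspot 1≤s s≤N
  ...   | y , refl = y , refl , (λ y∈ → s∉ (∈-map⁺ spot y∈)) , b≤s+m

  fails-window : ∀ {occ b} → parkOne N m (street occ) (spot b) ≡ nothing →
                 ∀ y → spot b ≤ spot y + m → y ∈ occ
  fails-window {occ} {b} e y b≤y+m = street-∈ (parkOne-fails {N} {m} {street occ} {spot b} (toℕ<n b) e (spot y) (s≤s z≤n) (toℕ<n y) b≤y+m)

  crowded : ∀ {occ} → (∀ i → suc i ∈ occ) → suc m ≤ length occ
  crowded {occ} taken = ≤-pred (covering-length {xs = zero ∷ occ} λ { zero → here refl ; (suc i) → there (taken i) })

  back-follows-seek : ∀ {occ} → zero ∉ occ → ∀ j fuel → j ≤ fuel → ∀ y {s} →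
                      back (street occ) (spot y) j ≡ just s → s ≡ spot (seek occ y fuel)
  back-follows-seek {occ} 0∉ (suc j) (suc fuel) (s≤s j≤fuel) y e
    rewrite free-street occ y with occupied? occ y in occ-y
  back-follows-seek {occ} 0∉ (suc j) (suc fuel) (s≤s j≤fuel) y refl | false = refl
  back-follows-seek {occ} 0∉ (suc j) (suc fuel) (s≤s j≤fuel) zero    e | true =
    ⊥-elim (0∉ (does-true (zero ∈? occ) occ-y))
  back-follows-seek {occ} 0∉ (suc j) (suc fuel) (s≤s j≤fuel) (suc i) e | true =
    back-follows-seek 0∉ j fuel j≤fuel (inject₁ i) (subst (λ t → back (street occ) (suc t) j ≡ just _) (sym (toℕ-inject₁ i)) e)

  -- A full backward window of m spots below the occupied circle spot suc i
  -- reaches spot 0, unless i is the last spot and then all spots but 0 are taken.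
  cramped : ∀ {occ} (i : Fin (suc m)) → suc i ∈ occ → (∀ y → toℕ y ≤ toℕ i → toℕ i < toℕ y + m → y ∈ occ) →
            zero ∈ occ ⊎ (∀ j → suc j ∈ occ)
  cramped {occ} i si∈ window with m≤n⇒m<n∨m≡n (Finᵖ.toℕ≤pred[n] i)
  ... | inj₁ i<m  = inj₁ (window zero z≤n i<m)
  ... | inj₂ i≡m  = inj₂ taken
    where
    taken : ∀ j → suc j ∈ occ
    taken j with m≤n⇒m<n∨m≡n (Finᵖ.toℕ≤pred[n] j)
    ... | inj₁ j<m = window (suc j) (subst (suc (toℕ j) ≤_) (sym i≡m) j<m)
                            (subst (_< suc (toℕ j) + m) (sym i≡m) (s≤s (m≤n+m m (toℕ j))))
    ... | inj₂ j≡m = subst (λ k → suc k ∈ occ) (Finᵖ.toℕ-injective (trans i≡m (sym j≡m))) si∈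

  parkOne-follows-circle : ∀ {occ} → zero ∉ occ → length occ ≤ m → ∀ b →
                           parkOne N m (street occ) (spot b) ≡ just (spot (seek occ b N))
  parkOne-follows-circle {occ} 0∉ few b with occupied? occ b in occ-b
  ... | false = parkOne-free N m (street occ) (spot b) (trans (free-street occ b) (cong not occ-b))
  ... | true with b
  ...   | zero  = ⊥-elim (0∉ (does-true (zero ∈? occ) occ-b))
  ...   | suc i with back (street occ) (suc (toℕ i)) m in eb
  ...     | just s  = parkOne-back N m (street occ) (spot (suc i)) (trans (free-street occ (suc i)) (cong not occ-b))
                                   (trans eb (cong just (back-follows-seek 0∉ m (suc m) (n≤1+n m) (inject₁ i) eb′)))
    where
    eb′ : back (street occ) (spot (inject₁ i)) m ≡ just s
    eb′ = subst (λ t → back (street occ) (suc t) m ≡ just s) (sym (toℕ-inject₁ i)) eb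
  ...     | nothing = ⊥-elim ([ 0∉ , (λ taken → 1+n≰n (≤-trans (crowded taken) few)) ]′
                                (cramped i (does-true (suc i ∈? occ) occ-b) window))
    where
    window : ∀ y → toℕ y ≤ toℕ i → toℕ i < toℕ y + m → y ∈ occ
    window y y≤i i<y+m = street-∈ (back-nothing (street occ) (suc (toℕ i)) m eb (spot y) (s≤s z≤n) (s≤s y≤i) (s≤s i<y+m))

  -- Phase 2: once circle spot 0 is taken, every car finds a free spot,
  -- because a full window would cover all spots but 0.
  parkOne-finds-room : ∀ {occ} → zero ∈ occ → length occ < N → ∀ b →
                       ∃ λ y → parkOne N m (street occ) (spot b) ≡ just (spot y) × y ∉ occ
  parkOne-finds-room {occ} 0∈ room b with parkOne N m (street occ) (spot b) in e
  ... | just s with parks-at-spot {occ} {b} e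
  ...   | y , refl , y∉ , _ = y , refl , y∉
  parkOne-finds-room {occ} 0∈ room b | nothing = ⊥-elim (<-irrefl refl (≤-trans room (covering-length all-taken)))
    where
    all-taken : ∀ y → y ∈ occ
    all-taken zero    = 0∈
    all-taken (suc j) = fails-window {occ} {b} e (suc j) (≤-trans (toℕ<n b) (s≤s (s≤s (m≤n+m m (toℕ j)))))

  parking-completes : ∀ {occ} → zero ∈ occ → ∀ bs → length occ + length bs ≤ N →
                      parkAll N m (street occ) (map spot bs) ≡ true
  parking-completes 0∈ []       room = refl
  parking-completes {occ} 0∈ (b ∷ bs) room with parkOne-finds-room 0∈ (≤-trans (s≤s (m≤m+n _ _)) (subst (_≤ N) (+-suc _ _) room)) b
  ... | y , e , _ = trans (parkAll-step (map spot bs) e) (parking-completes (there 0∈) bs (subst (_≤ N) (+-suc _ _) room))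

  isLast : Fin N → Bool
  isLast x = does (x Finᵖ.≟ fromℕ (suc m))

  -- The last car, when spot 1 is the only empty street spot, parks unless it
  -- prefers spot n: its window reaches spot 1 exactly when it prefers another spot.
  last-car : ∀ {occ} → Distinct occ → zero ∉ occ → length occ ≡ suc m → ∀ x →
             parkAll N m (street occ) (spot x ∷ []) ≡ not (isLast x)
  last-car {occ} d 0∉ len x with x Finᵖ.≟ fromℕ (suc m) | parkOne N m (street occ) (spot x) in e
  ... | yes refl | nothing = refl
  ... | yes refl | just s with parks-at-spot {occ} {x} e
  ...   | y , refl , y∉ , x≤y+m = ⊥-elim (1+n≰n (subst (λ t → suc t ≤ suc m) (Finᵖ.toℕ-fromℕ (suc m))
                                                   (subst (λ z → spot x ≤ spot z + m) y≡0 x≤y+m)))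
    where
    y≡0 : y ≡ zero
    y≡0 = missing-unique occ d len y∉ 0∉
  last-car {occ} d 0∉ len x | no x≢last | just s  = refl
  last-car {occ} d 0∉ len x | no x≢last | nothing = ⊥-elim (0∉ (fails-window {occ} {x} e zero (s≤s x≤m)))
    where
    x≤m : toℕ x ≤ m
    x≤m = ≤-pred (≤∧≢⇒< (Finᵖ.toℕ≤pred[n] x)
                  (λ x≡ → x≢last (Finᵖ.toℕ-injective (trans x≡ (sym (Finᵖ.toℕ-fromℕ (suc m)))))))

  naples-vs-circle : ∀ {occ} → Distinct occ → zero ∉ occ → ∀ bs x → length occ + length bs ≡ suc m →
    parkAll N m (street occ) (map spot bs ++ spot x ∷ []) ≡ not (isLast x ∧ not (occupied? (parkCircle occ bs) zero))
  naples-vs-circle {occ} d 0∉ [] x len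
    rewrite dec-false (zero ∈? occ) 0∉ | Boolᵖ.∧-identityʳ (isLast x) = last-car d 0∉ (trans (sym (+-identityʳ _)) len) x
  naples-vs-circle {occ} d 0∉ (b ∷ bs) x len =
    trans (parkAll-step (map spot bs ++ spot x ∷ []) (parkOne-follows-circle 0∉ few b)) (continue (c Finᵖ.≟ zero))
    where
    open ≡-Reasoning
    c = seek occ b N
    few : length occ ≤ m
    few = ≤-pred (subst (suc (length occ) ≤_) (trans (sym (+-suc _ _)) len) (s≤s (m≤m+n _ (length bs))))
    room : length (c ∷ occ) + length (bs ++ x ∷ []) ≤ N
    room = ≤-reflexive (cong suc (begin
      length occ + length (bs ++ x ∷ []) ≡⟨ cong (length occ +_) (trans (length-++ bs) (+-comm (length bs) 1)) ⟩
      length occ + suc (length bs)       ≡⟨ len ⟩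
      suc m                              ∎))
    continue : Dec (c ≡ zero) → parkAll N m (street (c ∷ occ)) (map spot bs ++ spot x ∷ []) ≡
                                not (isLast x ∧ not (occupied? (parkCircle (c ∷ occ) bs) zero))
    continue (yes c≡0) = begin
      parkAll N m (street (c ∷ occ)) (map spot bs ++ spot x ∷ [])   ≡⟨ cong (parkAll N m (street (c ∷ occ))) (map-++ spot bs (x ∷ [])) ⟨
      parkAll N m (street (c ∷ occ)) (map spot (bs ++ x ∷ []))      ≡⟨ parking-completes (here (sym c≡0)) (bs ++ x ∷ []) room ⟩
      true                                                          ≡⟨ cong not (Boolᵖ.∧-zeroʳ (isLast x)) ⟨
      not (isLast x ∧ false)                                        ≡⟨ cong (λ t → not (isLast x ∧ not t))
                                                                          (dec-true (zero ∈? _) (parkCircle-mono bs (here (sym c≡0)))) ⟨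
      not (isLast x ∧ not (occupied? (parkCircle (c ∷ occ) bs) zero)) ∎
    continue (no c≢0) = naples-vs-circle (seek-free occ 0∉ b ∷ d) 0∉′ bs x (trans (sym (+-suc _ _)) len)
      where
      0∉′ : zero ∉ c ∷ occ
      0∉′ (here 0≡c) = c≢0 (sym 0≡c)
      0∉′ (there 0∈) = 0∉ 0∈

  isPF : Vec (Fin N) N → Bool
  isPF v = parkAll N m [] (prefs v)

  leavesZero : Vec (Fin N) (suc m) → Bool
  leavesZero w = not (occupied? (circleOcc w) zero)

  isPF-∷ʳ : ∀ w x → isPF (w ∷ʳ x) ≡ not (isLast x ∧ leavesZero w)
  isPF-∷ʳ w x = begin
    parkAll N m [] (prefs (w ∷ʳ x))                      ≡⟨ cong (parkAll N m []) prefs-∷ʳ ⟩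
    parkAll N m [] (map spot (toList w) ++ spot x ∷ [])  ≡⟨ naples-vs-circle [] (λ ()) (toList w) x (length-toList w) ⟩
    not (isLast x ∧ leavesZero w)                        ∎
    where
    open ≡-Reasoning
    prefs-∷ʳ : prefs (w ∷ʳ x) ≡ map spot (toList w) ++ spot x ∷ []
    prefs-∷ʳ = trans (cong toList (map-∷ʳ spot x w))
               (trans (toList-∷ʳ (spot x) (Vec.map spot w)) (cong (_++ spot x ∷ []) (toList-map spot w)))

  failures↔centered : Sub (not ∘ isPF) ↔ Centered {suc m}
  failures↔centered = mk↔ₛ′ to from (λ { (w , _) → Sub-≡ (init-∷ʳ lastSpot w) }) from∘to
    where
    open ≡-Reasoning
    lastSpot = fromℕ (suc m)

    fails : ∀ v → not (isPF v) ≡ true → isLast (last v) ≡ true × leavesZero (init v) ≡ true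
    fails v q = ∧-true (begin
      isLast (last v) ∧ leavesZero (init v)             ≡⟨ Boolᵖ.not-involutive _ ⟨
      not (not (isLast (last v) ∧ leavesZero (init v))) ≡⟨ cong not (isPF-∷ʳ (init v) (last v)) ⟨
      not (isPF (init v ∷ʳ last v))                     ≡⟨ cong (not ∘ isPF) (proj₂ (proj₂ (initLast v))) ⟨
      not (isPF v)                                      ≡⟨ q ⟩
      true                                              ∎)

    to : Sub (not ∘ isPF) → Centered
    to (v , q) = init v , proj₂ (fails v q)

    from : Centered → Sub (not ∘ isPF)
    from (w , q) = w ∷ʳ lastSpot , (begin
      not (isPF (w ∷ʳ lastSpot))                    ≡⟨ cong not (isPF-∷ʳ w lastSpot) ⟩
      not (not (isLast lastSpot ∧ leavesZero w))    ≡⟨ Boolᵖ.not-involutive _ ⟩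
      isLast lastSpot ∧ leavesZero w                ≡⟨ cong (_∧ leavesZero w) (dec-true (lastSpot Finᵖ.≟ lastSpot) refl) ⟩
      leavesZero w                                  ≡⟨ q ⟩
      true                                          ∎)

    from∘to : ∀ x → from (to x) ≡ x
    from∘to (v , q) = Sub-≡ (begin
      init v ∷ʳ lastSpot ≡⟨ cong (init v ∷ʳ_) (does-true (last v Finᵖ.≟ lastSpot) (proj₁ (fails v q))) ⟨
      init v ∷ʳ last v   ≡⟨ proj₂ (proj₂ (initLast v)) ⟨
      v                  ∎)

corollary2p4 : (n : ℕ) → 2 ≤ n → Fin (n ^ n ∸ n ^ (n ∸ 2)) ↔ PF n (n ∸ 2)
corollary2p4 (suc (suc m)) (s≤s (s≤s z≤n)) = ↔-sym (Sub-complement isPF (Vec↔Fin^ N N) failures↔Fin)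
  where
  open Critical m
  -- PF n m is the set of n-tuples passing isPF. Its complement has n^m
  -- elements: Fin n × failures ≅ Fin n × centered tuples ≅ all (n-1)-tuples.
  failures↔Fin : Sub (not ∘ isPF) ↔ Fin (N ^ m)
  failures↔Fin = factor-cancel (proj₂ (Sub-finite (Vec↔Fin^ N N) (not ∘ isPF)))
                   (↔-trans (↔-refl ×-↔ failures↔centered) (↔-trans pollak (Vec↔Fin^ N (suc m))))
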